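{- Let $H$ be an $\mathcal A$-admissible hyperplane in $V$ and let $v$ be a regular element of $\mathcal C(\mathcal A)$. Let $u\in U=V^*$ be a linear form on $V$ which is non-negative on every element of $\mathcal A\cap H$ and on $\theta$. If $\langle u,v\rangle<0$, then $H\notin\mathrm{Hyp}(v,\mathcal A)$.
   Context: $V$ is a finite-dimensional real vector space, $\mathcal A$ a finite set of nonzero vectors spanning $V$ whose cone $\mathcal C(\mathcal A)$ (closed convex cone of non-negative combinations) is acute with nonempty interior. A point of $\mathcal C(\mathcal A)$ is regular if it lies on the boundary of no cone $\mathcal C(S)$, $S\subseteq\mathcal A$. A hyperplane of $V$ is $\mathcal A$-admissible if it is spanned by elements of $\mathcal A$. A linear functional $\mathrm{ht}$ on $V$ taking distinct positive values on the elements of $\mathcal A$ is fixed, and $\theta$ is the element of $\mathcal A$ of largest height. $\mathrm{Hyp}(v,\mathcal A)$ is the set of $\mathcal A$-admissible hyperplanes $H$ such that $v$ lies in the convex cone generated by $\theta$ and $\mathcal A\cap H$. -}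

module Defs where

open import Level using (0ℓ)
open import Data.Nat using (ℕ; zero; suc)
open import Data.Fin using (Fin; zero; suc)
open import Data.Bool using (Bool; true)
open import Data.Product using (Σ; ∃; _×_; _,_)
open import Data.Sum using (_⊎_)
open import Data.Unit using (⊤)
open import Relation.Nullary using (¬_)
open import Relation.Binary.PropositionalEquality using (_≡_)
open import Algebra.Structures using (IsCommutativeRing)
open import Relation.Binary.Structures using (IsStrictTotalOrder)

-- An ordered field with the least-upper-bound property (i.e. the real
-- numbers, axiomatised as a complete ordered field).  Equality is
-- propositional equality on the carrier.
record RealField : Set₁ where
  infixl 6 _+_
  infixl 7 _*_
  infix 4 _<_
  field
    Carrier : Set
    _+_ _*_ : Carrier → Carrier → Carrier
    -_      : Carrier → Carrier
    0# 1#   : Carrier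
    _<_     : Carrier → Carrier → Set
    isCommutativeRing : IsCommutativeRing _≡_ _+_ _*_ -_ 0# 1#
    0≢1     : ¬ (0# ≡ 1#)
    inverse : ∀ x → ¬ (x ≡ 0#) → Σ Carrier (λ y → x * y ≡ 1#)
    isStrictTotalOrder : IsStrictTotalOrder _≡_ _<_
    +-mono-< : ∀ {x y} z → x < y → x + z < y + z
    *-pos    : ∀ {x y} → 0# < x → 0# < y → 0# < x * y
  _≤_ : Carrier → Carrier → Set
  x ≤ y = x < y ⊎ x ≡ y
  field
    lub : (P : Carrier → Set) → Σ Carrier P →
          Σ Carrier (λ b → ∀ x → P x → x ≤ b) →
          Σ Carrier (λ s → (∀ x → P x → x ≤ s) ×
                           (∀ b → (∀ x → P x → x ≤ b) → s ≤ b))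

module Geometry (R : RealField) where
  open RealField R public

  infix 4 _≋_

  -- V = R^n (coordinates of a finite-dimensional real vector space),
  -- U = V^* represented by coefficient vectors.
  Vec : ℕ → Set
  Vec n = Fin n → Carrier

  _≋_ : ∀ {n} → Vec n → Vec n → Set
  x ≋ y = ∀ j → x j ≡ y j

  sumF : ∀ k → (Fin k → Carrier) → Carrier
  sumF zero    f = 0#
  sumF (suc k) f = f zero + sumF k (λ i → f (suc i))

  ⟨_,_⟩ : ∀ {n} → Vec n → Vec n → Carrier
  ⟨_,_⟩ {n} u x = sumF n (λ j → u j * x j)

  lincomb : ∀ {n m} → (Fin m → Vec n) → (Fin m → Carrier) → Vec n
  lincomb {n} {m} α c j = sumF m (λ i → c i * α i j)

  IsZero : ∀ {n} → Vec n → Set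
  IsZero x = ∀ j → x j ≡ 0#

  InSpan : ∀ {n m} → (Fin m → Vec n) → (Fin m → Set) → Vec n → Set
  InSpan {n} {m} α P x =
    Σ (Fin m → Carrier) λ c → (∀ i → ¬ P i → c i ≡ 0#) × (x ≋ lincomb α c)

  InCone : ∀ {n m} → (Fin m → Vec n) → (Fin m → Set) → Vec n → Set
  InCone {n} {m} α P x =
    Σ (Fin m → Carrier) λ c → (∀ i → 0# ≤ c i) × (∀ i → ¬ P i → c i ≡ 0#)
                              × (x ≋ lincomb α c)

  -- topology of R^n via sup-norm balls (same as the Euclidean topology)
  Near : ∀ {n} → Carrier → Vec n → Vec n → Set
  Near ε x y = ∀ j → (- ε < y j + - x j) × (y j + - x j < ε)

  Interior : ∀ {n} → (Vec n → Set) → Vec n → Set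
  Interior {n} C x = Σ Carrier λ ε → 0# < ε × (∀ y → Near ε x y → C y)

  Closure : ∀ {n} → (Vec n → Set) → Vec n → Set
  Closure {n} C x = ∀ ε → 0# < ε → Σ (Vec n) λ y → C y × Near ε x y

  Boundary : ∀ {n} → (Vec n → Set) → Vec n → Set
  Boundary C x = Closure C x × ¬ Interior C x

  -- subsets S of A = {α i}, as characteristic functions
  Subset : ℕ → Set
  Subset m = Fin m → Bool

  Cone : ∀ {n m} → (Fin m → Vec n) → Subset m → Vec n → Set
  Cone α S = InCone α (λ i → S i ≡ true)

  Regular : ∀ {n m} → (Fin m → Vec n) → Vec n → Set
  Regular {n} {m} α v = InCone α (λ _ → ⊤) v × (∀ (S : Subset m) → ¬ Boundary (Cone α S) v)

  Acute : ∀ {n m} → (Fin m → Vec n) → Set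
  Acute {n} {m} α = ∀ x → InCone α (λ _ → ⊤) x →
                      InCone α (λ _ → ⊤) (λ j → - x j) → IsZero x

  -- The hyperplane H = ker f (f a nonzero linear form).
  InH : ∀ {n} → Vec n → Vec n → Set
  InH f x = ⟨ f , x ⟩ ≡ 0#

  Admissible : ∀ {n m} → (Fin m → Vec n) → Vec n → Set
  Admissible {n} {m} α f =
    ¬ IsZero f × (∀ x → InH f x → InSpan α (λ i → InH f (α i)) x)

  -- H ∈ Hyp(v, A): v ∈ cone generated by θ = α t and A ∩ H
  InHyp : ∀ {n m} → (Fin m → Vec n) → Fin m → Vec n → Vec n → Set
  InHyp α t f v = InCone α (λ i → i ≡ t ⊎ InH f (α i)) v

-- If H ∈ Hyp(v, A), then v lies in the cone
-- generated by θ and A ∩ H, on which u is non-negative; this contradicts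
-- ⟨ u , v ⟩ < 0.
module Submission where

open import Defs
open import Data.Nat using (ℕ; zero; suc)
open import Data.Unit using (⊤)
open import Data.Fin using (Fin; zero; suc)
open import Data.Product using (Σ; _,_)
open import Data.Sum using (_⊎_; inj₁; inj₂)
open import Relation.Nullary using (¬_)
open import Relation.Binary using (tri<; tri≈; tri>)
open import Relation.Binary.PropositionalEquality
  using (_≡_; refl; sym; trans; cong; cong₂; subst; module ≡-Reasoning)
open import Algebra.Bundles using (CommutativeRing)
import Algebra.Properties.CommutativeSemigroup as CommutativeSemigroupProperties
open import Relation.Binary.Structures using (IsStrictTotalOrder)

module ConeGeometry (R : RealField) where
  open Geometry R
  open ≡-Reasoning

  ring : CommutativeRing _ _
  ring = record { isCommutativeRing = isCommutativeRing }

  open CommutativeRing ring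
    using (+-identityˡ; *-assoc; *-comm; distribˡ; zeroˡ; zeroʳ; +-commutativeSemigroup)
  open CommutativeSemigroupProperties +-commutativeSemigroup using (interchange)
  module O = IsStrictTotalOrder isStrictTotalOrder

  sumF-cong : ∀ k {f g : Fin k → Carrier} → (∀ i → f i ≡ g i) → sumF k f ≡ sumF k g
  sumF-cong zero    f≡g = refl
  sumF-cong (suc k) f≡g = cong₂ _+_ (f≡g zero) (sumF-cong k (λ i → f≡g (suc i)))

  sumF-zero : ∀ k → sumF k (λ _ → 0#) ≡ 0#
  sumF-zero zero    = refl
  sumF-zero (suc k) = trans (cong (0# +_) (sumF-zero k)) (+-identityˡ 0#)

  sumF-+ : ∀ k (f g : Fin k → Carrier) →
           sumF k (λ i → f i + g i) ≡ sumF k f + sumF k g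
  sumF-+ zero    f g = sym (+-identityˡ 0#)
  sumF-+ (suc k) f g =
    trans (cong ((f zero + g zero) +_) (sumF-+ k _ _)) (interchange _ _ _ _)

  *-sumF : ∀ k x (f : Fin k → Carrier) → x * sumF k f ≡ sumF k (λ i → x * f i)
  *-sumF zero    x f = zeroʳ x
  *-sumF (suc k) x f = trans (distribˡ x _ _) (cong ((x * f zero) +_) (*-sumF k x _))

  sumF-comm : ∀ n m (F : Fin m → Fin n → Carrier) →
              sumF n (λ j → sumF m (λ i → F i j)) ≡ sumF m (λ i → sumF n (F i))
  sumF-comm zero    m F = sym (sumF-zero m)
  sumF-comm (suc n) m F = begin
    sumF m (λ i → F i zero) + sumF n (λ j → sumF m (λ i → F i (suc j)))
      ≡⟨ cong (sumF m (λ i → F i zero) +_) (sumF-comm n m (λ i j → F i (suc j))) ⟩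
    sumF m (λ i → F i zero) + sumF m (λ i → sumF n (λ j → F i (suc j)))
      ≡⟨ sym (sumF-+ m _ _) ⟩
    sumF m (λ i → sumF (suc n) (F i)) ∎

  ⟨⟩-lincomb : ∀ {n m} (u : Vec n) (α : Fin m → Vec n) (c : Fin m → Carrier) →
               ⟨ u , lincomb α c ⟩ ≡ sumF m (λ i → c i * ⟨ u , α i ⟩)
  ⟨⟩-lincomb {n} {m} u α c = begin
    sumF n (λ j → u j * sumF m (λ i → c i * α i j))
      ≡⟨ sumF-cong n (λ j → *-sumF m (u j) _) ⟩
    sumF n (λ j → sumF m (λ i → u j * (c i * α i j)))
      ≡⟨ sumF-comm n m _ ⟩
    sumF m (λ i → sumF n (λ j → u j * (c i * α i j)))
      ≡⟨ sumF-cong m (λ i → sumF-cong n (λ j → *-left-commute (u j) (c i) (α i j))) ⟩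
    sumF m (λ i → sumF n (λ j → c i * (u j * α i j)))
      ≡⟨ sumF-cong m (λ i → sym (*-sumF n (c i) _)) ⟩
    sumF m (λ i → c i * ⟨ u , α i ⟩) ∎
    where
    *-left-commute : ∀ a b d → a * (b * d) ≡ b * (a * d)
    *-left-commute a b d =
      trans (sym (*-assoc a b d)) (trans (cong (_* d) (*-comm a b)) (*-assoc b a d))

  ⟨⟩-cong : ∀ {n} (u : Vec n) {x y : Vec n} → x ≋ y → ⟨ u , x ⟩ ≡ ⟨ u , y ⟩
  ⟨⟩-cong {n} u x≋y = sumF-cong n (λ j → cong (u j *_) (x≋y j))

  ≤-<-trans : ∀ {a b c} → a ≤ b → b < c → a < c
  ≤-<-trans (inj₁ a<b) b<c = O.trans a<b b<c
  ≤-<-trans (inj₂ refl) b<c = b<c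

  <⇒≱ : ∀ {a b} → a < b → ¬ b ≤ a
  <⇒≱ a<b b≤a = O.irrefl refl (≤-<-trans b≤a a<b)

  +-nonneg : ∀ {a b} → 0# ≤ a → 0# ≤ b → 0# ≤ (a + b)
  +-nonneg {a} {b} (inj₁ 0<a) 0≤b =
    inj₁ (≤-<-trans 0≤b (subst (_< a + b) (+-identityˡ b) (+-mono-< b 0<a)))
  +-nonneg {a} {b} (inj₂ refl) 0≤b = subst (0# ≤_) (sym (+-identityˡ b)) 0≤b

  *-nonneg : ∀ {a b} → 0# ≤ a → 0# ≤ b → 0# ≤ (a * b)
  *-nonneg (inj₁ 0<a) (inj₁ 0<b)  = inj₁ (*-pos 0<a 0<b)
  *-nonneg {a} (inj₁ _) (inj₂ refl) = inj₂ (sym (zeroʳ a))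
  *-nonneg {_} {b} (inj₂ refl) _    = inj₂ (sym (zeroˡ b))

  sumF-nonneg : ∀ k (f : Fin k → Carrier) → (∀ i → 0# ≤ f i) → 0# ≤ sumF k f
  sumF-nonneg zero    f f≥0 = inj₂ refl
  sumF-nonneg (suc k) f f≥0 = +-nonneg (f≥0 zero) (sumF-nonneg k _ (λ i → f≥0 (suc i)))

  ⟨⟩-nonneg-on-cone : ∀ {n m} (α : Fin m → Vec n) (P : Fin m → Set) (u : Vec n) →
                      (∀ i → P i → 0# ≤ ⟨ u , α i ⟩) →
                      ∀ {x} → InCone α P x → 0# ≤ ⟨ u , x ⟩
  ⟨⟩-nonneg-on-cone {n} {m} α P u u≥0 {x} (c , c≥0 , c-outside , x≋) =
    subst (0# ≤_) (sym (trans (⟨⟩-cong u x≋) (⟨⟩-lincomb u α c)))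
          (sumF-nonneg m _ term-nonneg)
    where
    -- A generator on which u is negative lies outside P, so its coefficient vanishes.
    term-nonneg : ∀ i → 0# ≤ (c i * ⟨ u , α i ⟩)
    term-nonneg i with O.compare ⟨ u , α i ⟩ 0#
    ... | tri< u<0 _ _ =
      inj₂ (sym (trans (cong (_* ⟨ u , α i ⟩) (c-outside i (λ p → <⇒≱ u<0 (u≥0 i p))))
                       (zeroˡ _)))
    ... | tri≈ _ u≡0 _ = *-nonneg (c≥0 i) (inj₂ (sym u≡0))
    ... | tri> _ _ u>0 = *-nonneg (c≥0 i) (inj₁ u>0)

proposition5p3 : (R : RealField) → let open Geometry R in
    (n m : ℕ) (α : Fin m → Vec n) →
    -- the elements of A are nonzero and pairwise distinct
    (∀ i → ¬ IsZero (α i)) →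
    (∀ i k → α i ≋ α k → i ≡ k) →
    -- A spans V
    (∀ x → InSpan α (λ _ → ⊤) x) →
    -- C(A) is acute with nonempty interior
    Acute α →
    Σ (Vec n) (Interior (InCone α (λ _ → ⊤))) →
    -- ht: a linear form with distinct positive values on A
    (ht : Vec n) →
    (∀ i → 0# < ⟨ ht , α i ⟩) →
    (∀ i k → ⟨ ht , α i ⟩ ≡ ⟨ ht , α k ⟩ → i ≡ k) →
    -- θ = α t is the element of A of largest height
    (t : Fin m) → (∀ i → ⟨ ht , α i ⟩ ≤ ⟨ ht , α t ⟩) →
    -- H = ker f is an A-admissible hyperplane
    (f : Vec n) → Admissible α f →
    -- v is a regular element of C(A)
    (v : Vec n) → Regular α v →
    -- u ∈ V^* non-negative on A ∩ H and on θ
    (u : Vec n) →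
    (∀ i → InH f (α i) → 0# ≤ ⟨ u , α i ⟩) →
    0# ≤ ⟨ u , α t ⟩ →
    ⟨ u , v ⟩ < 0# →
    ¬ InHyp α t f v
proposition5p3 R n m α _ _ _ _ _ ht _ _ t _ f _ v _ u u≥0-on-H u≥0-at-θ u·v<0 v∈Hyp =
  <⇒≱ u·v<0 (⟨⟩-nonneg-on-cone α _ u u≥0-on-generators v∈Hyp)
  where
  open Geometry R
  open ConeGeometry R
  u≥0-on-generators : ∀ i → (i ≡ t ⊎ InH f (α i)) → 0# ≤ ⟨ u , α i ⟩
  u≥0-on-generators i (inj₁ refl) = u≥0-at-θ
  u≥0-on-generators i (inj₂ i∈H)  = u≥0-on-H i i∈H
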